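{- Let $n,d$ be positive integers. For every integer $k\geq n^{8d}$ there exists $\mathbf{y}\in\{0,\dots,k\}^n$ such that for any $\mathbf{z}^{(1)}\neq\mathbf{z}^{(2)}\in\{0,\dots,d\}^n$ satisfying $\sum_{j=1}^n z^{(i)}_j\leq 2d$ for $i\in\{1,2\}$, it holds that $\langle\mathbf{y},\mathbf{z}^{(1)}\rangle\neq\langle\mathbf{y},\mathbf{z}^{(2)}\rangle$.
   Context: $\langle\mathbf{y},\mathbf{z}\rangle=\sum_{j=1}^n y_jz_j$ is the standard inner product. -}

module Defs where

open import Data.Nat using (ℕ; zero; suc; _+_; _*_)
open import Data.Fin using (Fin; zero; suc)

sumFin : (n : ℕ) → (Fin n → ℕ) → ℕ
sumFin zero    f = 0
sumFin (suc n) f = f zero + sumFin n (λ j → f (suc j))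

⟨_,_⟩ : {n : ℕ} → (Fin n → ℕ) → (Fin n → ℕ) → ℕ
⟨_,_⟩ {n} y z = sumFin n (λ j → y j * z j)

-- Build y one coordinate at a time, keeping it injective on all weight vectors
-- of total weight ≤ s. Prepending c to y breaks this only through a collision
-- c t₁ + A = c t₂ + B with t₁ < t₂ ≤ s and A, B values of ⟨y, z⟩ of weight ≤ s,
-- i.e. only if c = (A − B) / (t₂ − t₁). A vector of length m has at most
-- (m + 1)^s such values, so at most n^{2s} s ≤ n^{4s} values of c are forbidden,
-- and for s = 2d some c ∈ {0, …, k} survives.
module Submission where

open import Defs
open import Data.Nat using (ℕ; _≤_; _^_; _*_; NonZero)
open import Data.Fin using (Fin)
open import Data.Product using (Σ; _×_)
open import Relation.Binary.PropositionalEquality using (_≡_; _≢_)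
open import Relation.Nullary using (¬_)

open import Data.Nat using (zero; suc; _+_; _∸_; _<_; z≤n; s≤s; _≟_; _/_)
open import Data.Nat.Properties
open import Data.Nat.DivMod using (m*n/n≡m)
open import Data.Nat.Tactic.RingSolver using (solve-∀)
open import Data.Fin using (zero; suc)
open import Data.Vec.Functional using (toList; tail) renaming (_∷_ to _∷ᶠ_)
open import Data.List using (List; []; _∷_; [_]; _++_; length; map; filter; upTo; cartesianProduct; cartesianProductWith)
open import Data.List.Properties using (length-++; length-map; length-tabulate; length-upTo; filter-notAll)
open import Data.List.Relation.Unary.Any as Any using (here; there)
open import Data.List.Membership.Propositional using (_∈_; _∉_)
open import Data.List.Membership.Propositional.Properties
  using (∈-cartesianProductWith⁺; ∈-cartesianProduct⁺; ∈-upTo⁺; ∈-tabulate⁺; ∈-filter⁺)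
open import Data.List.Membership.DecPropositional _≟_ using (_∈?_)
open import Data.Product using (_,_)
open import Data.Empty using (⊥-elim)
open import Function using (_∘_)
open import Relation.Nullary using (yes; no; ¬?)
open import Relation.Binary using (tri<; tri≈; tri>)
open import Relation.Binary.PropositionalEquality using (refl; sym; trans; cong; cong₂; subst; module ≡-Reasoning)

length-cartesianProductWith : ∀ {A B C : Set} (f : A → B → C) (xs : List A) (ys : List B) →
  length (cartesianProductWith f xs ys) ≡ length xs * length ys
length-cartesianProductWith f []       ys = refl
length-cartesianProductWith f (x ∷ xs) ys = begin
  length (map (f x) ys ++ cartesianProductWith f xs ys)
    ≡⟨ length-++ (map (f x) ys) ⟩
  length (map (f x) ys) + length (cartesianProductWith f xs ys)
    ≡⟨ cong₂ _+_ (length-map (f x) ys) (length-cartesianProductWith f xs ys) ⟩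
  length ys + length xs * length ys ∎
  where open ≡-Reasoning

∃-∉-≤ : ∀ N (xs : List ℕ) → length xs ≤ N → Σ ℕ λ c → c ≤ N × c ∉ xs
∃-∉-≤ zero    []  _     = 0 , z≤n , λ ()
∃-∉-≤ (suc N) xs  |xs|≤ with suc N ∈? xs
... | no  N∉xs = suc N , ≤-refl , N∉xs
... | yes N∈xs = avoidedInXs (∃-∉-≤ N (filter ≢N? xs) |filter|≤N)
  where
  ≢N? = λ x → ¬? (x ≟ suc N)
  |filter|≤N : length (filter ≢N? xs) ≤ N
  |filter|≤N = ≤-pred (≤-trans (filter-notAll ≢N? xs
                 (Any.map (λ N≡x x≢N → x≢N (sym N≡x)) N∈xs)) |xs|≤)
  avoidedInXs : Σ ℕ (λ c → c ≤ N × c ∉ filter ≢N? xs) → Σ ℕ λ c → c ≤ suc N × c ∉ xs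
  avoidedInXs (c , c≤N , c∉) = c , m≤n⇒m≤1+n c≤N ,
    λ c∈xs → c∉ (∈-filter⁺ ≢N? c∈xs λ { refl → <-irrefl refl (s≤s c≤N) })

n<2^n : ∀ n → n < 2 ^ n
n<2^n zero    = s≤s z≤n
n<2^n (suc n) = +-mono-≤ (m^n>0 2 n) (≤-trans (n<2^n n) (m≤m+n (2 ^ n) 0))

sumsOfAtMost : List ℕ → ℕ → List ℕ
sumsOfAtMost g zero    = [ 0 ]
sumsOfAtMost g (suc s) = 0 ∷ cartesianProductWith _+_ g (sumsOfAtMost g s)

0∈sumsOfAtMost : ∀ g s → 0 ∈ sumsOfAtMost g s
0∈sumsOfAtMost g zero    = here refl
0∈sumsOfAtMost g (suc s) = here refl

length-sumsOfAtMost : ∀ g s → length (sumsOfAtMost g s) ≤ suc (length g) ^ s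
length-sumsOfAtMost g zero    = ≤-refl
length-sumsOfAtMost g (suc s) = begin
  suc (length (cartesianProductWith _+_ g (sumsOfAtMost g s)))
    ≡⟨ cong suc (length-cartesianProductWith _+_ g (sumsOfAtMost g s)) ⟩
  suc (length g * length (sumsOfAtMost g s)) ≤⟨ s≤s (*-monoʳ-≤ (length g) (length-sumsOfAtMost g s)) ⟩
  suc (length g * suc (length g) ^ s)        ≤⟨ +-monoˡ-≤ _ (m^n>0 (suc (length g)) s) ⟩
  suc (length g) ^ suc s                     ∎
  where open ≤-Reasoning

*+-∈-sumsOfAtMost : ∀ {g a v} → a ∈ g → ∀ t s → t ≤ s → v ∈ sumsOfAtMost g (s ∸ t) →
  t * a + v ∈ sumsOfAtMost g s
*+-∈-sumsOfAtMost a∈g zero    s       _         v∈ = v∈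
*+-∈-sumsOfAtMost {g} {a} {v} a∈g (suc t) (suc s) (s≤s t≤s) v∈ =
  subst (_∈ sumsOfAtMost g (suc s)) (sym (+-assoc a (t * a) v))
    (there (∈-cartesianProductWith⁺ _+_ a∈g (*+-∈-sumsOfAtMost a∈g t s t≤s v∈)))

⟨⟩-∈-sumsOfAtMost : ∀ {g} m (y z : Fin m → ℕ) s → (∀ j → y j ∈ g) → sumFin m z ≤ s →
  ⟨ y , z ⟩ ∈ sumsOfAtMost g s
⟨⟩-∈-sumsOfAtMost {g} zero    y z s y∈g _  = 0∈sumsOfAtMost g s
⟨⟩-∈-sumsOfAtMost {g} (suc m) y z s y∈g Σz≤s =
  subst (_∈ sumsOfAtMost g s) (cong (_+ ⟨ tail y , tail z ⟩) (*-comm (z zero) (y zero)))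
    (*+-∈-sumsOfAtMost (y∈g zero) (z zero) s (m+n≤o⇒m≤o (z zero) Σz≤s)
      (⟨⟩-∈-sumsOfAtMost m (tail y) (tail z) (s ∸ z zero) (y∈g ∘ suc)
        (m+n≤o⇒m≤o∸n (sumFin m (tail z)) (subst (_≤ s) (+-comm (z zero) _) Σz≤s))))

quotients : ℕ → List ℕ → List ℕ
quotients D vs = cartesianProductWith (λ (A , B) e → (A ∸ B) / suc e) (cartesianProduct vs vs) (upTo D)

length-quotients : ∀ D vs → length (quotients D vs) ≡ length vs * length vs * D
length-quotients D vs = begin
  length (quotients D vs)
    ≡⟨ length-cartesianProductWith _ (cartesianProduct vs vs) (upTo D) ⟩
  length (cartesianProduct vs vs) * length (upTo D)
    ≡⟨ cong₂ _*_ (length-cartesianProductWith _,_ vs vs) (length-upTo D) ⟩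
  length vs * length vs * D ∎
  where open ≡-Reasoning

∈-quotients : ∀ {D vs A B c e} → A ∈ vs → B ∈ vs → e < D → A ≡ c * suc e + B → c ∈ quotients D vs
∈-quotients {B = B} {c} {e} A∈vs B∈vs e<D refl =
  subst (_∈ _) quotient≡c
    (∈-cartesianProductWith⁺ (λ (A , B) e → (A ∸ B) / suc e) (∈-cartesianProduct⁺ A∈vs B∈vs) (∈-upTo⁺ e<D))
  where
  open ≡-Reasoning
  quotient≡c : (c * suc e + B ∸ B) / suc e ≡ c
  quotient≡c = begin
    (c * suc e + B ∸ B) / suc e ≡⟨ cong (_/ suc e) (m+n∸n≡m (c * suc e) B) ⟩
    c * suc e / suc e           ≡⟨ m*n/n≡m c (suc e) ⟩
    c                           ∎

collision⇒∈-quotients : ∀ {D vs A B c t₁ t₂} → A ∈ vs → B ∈ vs → t₁ < t₂ → t₂ ≤ D →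
  c * t₁ + A ≡ c * t₂ + B → c ∈ quotients D vs
collision⇒∈-quotients {A = A} {B} {c} {t₁} A∈vs B∈vs t₁<t₂ t₂≤D eq
  with o , refl ← m≤n⇒∃[o]m+o≡n t₁<t₂ =
  ∈-quotients A∈vs B∈vs (≤-trans (s≤s (m≤n+m o t₁)) t₂≤D) (+-cancelˡ-≡ (c * t₁) A _ (begin
    c * t₁ + A                     ≡⟨ eq ⟩
    c * (suc t₁ + o) + B           ≡⟨ cong (λ t → c * t + B) (sym (+-suc t₁ o)) ⟩
    c * (t₁ + suc o) + B           ≡⟨ cong (_+ B) (*-distribˡ-+ c t₁ (suc o)) ⟩
    c * t₁ + c * suc o + B         ≡⟨ +-assoc (c * t₁) (c * suc o) B ⟩
    c * t₁ + (c * suc o + B)       ∎))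
  where open ≡-Reasoning

SumInjective : ∀ {m} → ℕ → (Fin m → ℕ) → Set
SumInjective {m} s y = (z₁ z₂ : Fin m → ℕ) → sumFin m z₁ ≤ s → sumFin m z₂ ≤ s →
  ⟨ y , z₁ ⟩ ≡ ⟨ y , z₂ ⟩ → (j : Fin m) → z₁ j ≡ z₂ j

forbidden : ∀ {m} → ℕ → (Fin m → ℕ) → List ℕ
forbidden s y = quotients s (sumsOfAtMost (toList y) s)

length-forbidden : ∀ {m} s (y : Fin m → ℕ) → length (forbidden s y) ≤ suc m ^ s * suc m ^ s * s
length-forbidden {m} s y = begin
  length (forbidden s y)                 ≡⟨ length-quotients s sums ⟩
  length sums * length sums * s          ≤⟨ *-monoˡ-≤ s (*-mono-≤ |sums|≤ |sums|≤) ⟩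
  suc m ^ s * suc m ^ s * s              ∎
  where
  open ≤-Reasoning
  sums = sumsOfAtMost (toList y) s
  |sums|≤ : length sums ≤ suc m ^ s
  |sums|≤ = subst (λ l → length sums ≤ suc l ^ s) (length-tabulate y) (length-sumsOfAtMost (toList y) s)

∷-collision⇒∈-forbidden : ∀ {m s c} {y : Fin m → ℕ} (z₁ z₂ : Fin (suc m) → ℕ) → z₁ zero < z₂ zero →
  sumFin (suc m) z₁ ≤ s → sumFin (suc m) z₂ ≤ s →
  ⟨ c ∷ᶠ y , z₁ ⟩ ≡ ⟨ c ∷ᶠ y , z₂ ⟩ → c ∈ forbidden s y
∷-collision⇒∈-forbidden {m} {s} {c} {y} z₁ z₂ z₁<z₂ Σz₁≤s Σz₂≤s eq =
  collision⇒∈-quotients (tail∈ z₁ Σz₁≤s) (tail∈ z₂ Σz₂≤s) z₁<z₂ (m+n≤o⇒m≤o (z₂ zero) Σz₂≤s) eq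
  where
  tail∈ : ∀ z → sumFin (suc m) z ≤ s → ⟨ y , tail z ⟩ ∈ sumsOfAtMost (toList y) s
  tail∈ z Σz≤s = ⟨⟩-∈-sumsOfAtMost m y (tail z) s (∈-tabulate⁺ {f = y}) (m+n≤o⇒n≤o (z zero) Σz≤s)

∷-sumInjective : ∀ {m s c} {y : Fin m → ℕ} → SumInjective s y → c ∉ forbidden s y →
  SumInjective s (c ∷ᶠ y)
∷-sumInjective {c = c} inj c∉ z₁ z₂ Σz₁≤s Σz₂≤s eq with <-cmp (z₁ zero) (z₂ zero)
... | tri< z₁<z₂ _ _ = ⊥-elim (c∉ (∷-collision⇒∈-forbidden z₁ z₂ z₁<z₂ Σz₁≤s Σz₂≤s eq))
... | tri> _ _ z₂<z₁ = ⊥-elim (c∉ (∷-collision⇒∈-forbidden z₂ z₁ z₂<z₁ Σz₂≤s Σz₁≤s (sym eq)))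
... | tri≈ _ z₁0≡z₂0 _ = λ
  { zero    → z₁0≡z₂0
  ; (suc j) → inj (tail z₁) (tail z₂) (m+n≤o⇒n≤o (z₁ zero) Σz₁≤s) (m+n≤o⇒n≤o (z₂ zero) Σz₂≤s)
                (+-cancelˡ-≡ (c * z₁ zero) _ _ (trans eq (cong (λ t → c * t + _) (sym z₁0≡z₂0)))) j
  }

∃-bounded-sumInjective : ∀ s k m → m ^ s * m ^ s * s ≤ k →
  Σ (Fin m → ℕ) λ y → ((j : Fin m) → y j ≤ k) × SumInjective s y
∃-bounded-sumInjective s k zero    _     = (λ ()) , (λ ()) , λ _ _ _ _ _ ()
∃-bounded-sumInjective s k (suc m) bound
  with y , y≤k , inj ← ∃-bounded-sumInjective s k m
         (≤-trans (*-monoˡ-≤ s (*-mono-≤ (^-monoˡ-≤ s (n≤1+n m)) (^-monoˡ-≤ s (n≤1+n m)))) bound)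
  with c , c≤k , c∉ ← ∃-∉-≤ k (forbidden s y) (≤-trans (length-forbidden s y) bound)
  = c ∷ᶠ y , (λ { zero → c≤k ; (suc j) → y≤k j }) , ∷-sumInjective inj c∉

n^s*n^s*s≤n^[4*s] : ∀ n s → 2 ≤ n → n ^ s * n ^ s * s ≤ n ^ (4 * s)
n^s*n^s*s≤n^[4*s] 1 s (s≤s ())
n^s*n^s*s≤n^[4*s] n@(suc (suc _)) s 2≤n = begin
  n ^ s * n ^ s * s               ≤⟨ *-monoʳ-≤ (n ^ s * n ^ s) s≤n^s*n^s ⟩
  n ^ s * n ^ s * (n ^ s * n ^ s) ≡⟨ sym (cong₂ _*_ (^-distribˡ-+-* n s s) (^-distribˡ-+-* n s s)) ⟩
  n ^ (s + s) * n ^ (s + s)       ≡⟨ sym (^-distribˡ-+-* n (s + s) (s + s)) ⟩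
  n ^ (s + s + (s + s))           ≡⟨ cong (n ^_) (exponent s) ⟩
  n ^ (4 * s)                     ∎
  where
  open ≤-Reasoning
  exponent : ∀ s → s + s + (s + s) ≡ 4 * s
  exponent = solve-∀
  s≤n^s*n^s : s ≤ n ^ s * n ^ s
  s≤n^s*n^s = ≤-trans (<⇒≤ (n<2^n s))
    (≤-trans (^-monoˡ-≤ s 2≤n) (m≤m*n (n ^ s) (n ^ s) {{m^n≢0 n s}}))

∃-sumInjective-≤-^[4*s] : ∀ n s k → .{{NonZero n}} → n ^ (4 * s) ≤ k →
  Σ (Fin n → ℕ) λ y → ((j : Fin n) → y j ≤ k) × SumInjective s y
-- For n = 1 the counting bound fails (the s forbidden values are all 0), but the
-- single coordinate 1 separates directly.
∃-sumInjective-≤-^[4*s] 1 s k 1^4s≤k =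
  (λ _ → 1) , (λ _ → ≤-trans (≤-reflexive (sym (^-zeroˡ (4 * s)))) 1^4s≤k) ,
  λ { z₁ z₂ _ _ eq zero → begin
        z₁ zero          ≡⟨ sym (1*a+0≡a (z₁ zero)) ⟩
        1 * z₁ zero + 0  ≡⟨ eq ⟩
        1 * z₂ zero + 0  ≡⟨ 1*a+0≡a (z₂ zero) ⟩
        z₂ zero          ∎ }
  where
  open ≡-Reasoning
  1*a+0≡a : ∀ a → 1 * a + 0 ≡ a
  1*a+0≡a a = trans (+-identityʳ (1 * a)) (*-identityˡ a)
∃-sumInjective-≤-^[4*s] n@(suc (suc _)) s k n^4s≤k =
  ∃-bounded-sumInjective s k n (≤-trans (n^s*n^s*s≤n^[4*s] n s (s≤s (s≤s z≤n))) n^4s≤k)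

lemma4p15 : (n d : ℕ) → .{{NonZero n}} → .{{NonZero d}} →
    (k : ℕ) → n ^ (8 * d) ≤ k →
    Σ (Fin n → ℕ) λ y → ((j : Fin n) → y j ≤ k) ×
      ((z₁ z₂ : Fin n → ℕ) →
        ((j : Fin n) → z₁ j ≤ d) → ((j : Fin n) → z₂ j ≤ d) →
        sumFin n z₁ ≤ 2 * d → sumFin n z₂ ≤ 2 * d →
        ¬ ((j : Fin n) → z₁ j ≡ z₂ j) →
        ⟨ y , z₁ ⟩ ≢ ⟨ y , z₂ ⟩)
lemma4p15 n d k n^8d≤k
  with y , y≤k , inj ← ∃-sumInjective-≤-^[4*s] n (2 * d) k
         (subst (λ e → n ^ e ≤ k) (*-assoc 4 2 d) n^8d≤k)
  = y , y≤k , λ z₁ z₂ _ _ Σz₁≤2d Σz₂≤2d z₁≢z₂ eq → z₁≢z₂ (inj z₁ z₂ Σz₁≤2d Σz₂≤2d eq)
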